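{- For every $n\ge2$ there is a bijection $\phi_1:\mathcal{A}_n\cap\mathcal{P}_1\to\mathcal{A}_{n-1}\cap\mathcal{A}^*$ such that for all $s$: $\mathrm{asc}(s)=\mathrm{asc}(\phi_1(s))+1$, $\mathrm{rmin}(s)=\mathrm{rmin}(\phi_1(s))+1$, and $\mathrm{rep},\mathrm{zero},\max,\mathrm{ealm},\mathrm{rpos}$ take the same values on $s$ and $\phi_1(s)$.
   Context: Inversion sequence: $s=(s_1,\dots,s_n)$, $0\le s_i<i$, $|s|=n$. $\mathrm{asc}(s)=|\{i:s_i<s_{i+1}\}|$. Ascent sequence: $s_i\le\mathrm{asc}(s_1,\dots,s_{i-1})+1$ for $i\ge2$; $\mathcal{A}_n$ = ascent sequences of length $n$; $\mathcal{A}^*$ = all ascent sequences except those of the form $(0,1,\dots,|s|-1)$. $\mathcal{P}_1$ = set of $s\in\mathcal{A}^*$ with $s_{|s|-1}<s_{|s|}=\mathrm{asc}(s)$. $\mathrm{rep}(s)=n-|\{s_i\}|$, $\mathrm{zero}(s)=|\{i:s_i=0\}|$, $\max(s)=|\{i:s_i=i-1\}|$, $\mathrm{ealm}(s)=s_{\max(s)+1}$ if $\max(s)\ne|s|$ and $0$ otherwise. $\mathrm{Rmin}(s)=\{s_i:s_i<s_j\ \forall j>i\}$, $\mathrm{rmin}(s)=|\mathrm{Rmin}(s)|$, $\mathrm{Rmin}(s)_j$ its $j$-th smallest element ($j\ge0$). $\mathrm{rpos}(s)$ is the maximal $m$ such that $\mathrm{Rmin}(s)_m$ occurs at least twice after the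 position of the right-to-left minimum $\mathrm{Rmin}(s)_{m-1}$ (for $m=0$: at least twice in $s$); $0$ if none exists or $\mathrm{rmin}(s)=|s|$. -}

module Defs where

open import Data.Nat using (ℕ; zero; suc; _+_; _∸_; _≡ᵇ_; _<ᵇ_; _⊔_)
open import Data.Bool using (Bool; true; false; _∧_; _∨_; not; if_then_else_)
open import Data.List using (List; []; _∷_; length; filter; reverse; drop; _++_)
open import Data.Product using (Σ; _,_; proj₁)
open import Data.Unit using (⊤)
open import Data.Empty using (⊥)
open import Relation.Nullary.Decidable using (does)
open import Data.Bool using (T)

-- Sequences are lists of naturals  s = (s_1, ..., s_n)  (list position i-1 holds s_i).

_≤ᵇ_ : ℕ → ℕ → Bool
m ≤ᵇ n = m <ᵇ suc n

count : (ℕ → Bool) → List ℕ → ℕ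
count p []       = 0
count p (x ∷ xs) = if p x then suc (count p xs) else count p xs

asc : List ℕ → ℕ
asc []             = 0
asc (x ∷ [])       = 0
asc (x ∷ y ∷ xs)   = (if x <ᵇ y then 1 else 0) + asc (y ∷ xs)

isInvFrom : ℕ → List ℕ → Bool
isInvFrom k []       = true
isInvFrom k (x ∷ xs) = (x <ᵇ k) ∧ isInvFrom (suc k) xs

isInv : List ℕ → Bool
isInv = isInvFrom 1

-- ascent condition: s_i ≤ asc(s_1..s_{i-1}) + 1 for i ≥ 2.
-- Checked by processing the sequence left to right, carrying the previous
-- entry and the number of ascents of the prefix seen so far.
ascCond : ℕ → ℕ → List ℕ → Bool
ascCond prev a []       = true
ascCond prev a (x ∷ xs) =
  (x ≤ᵇ suc a) ∧ ascCond x ((if prev <ᵇ x then 1 else 0) + a) xs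

isAscent : List ℕ → Bool
isAscent []       = true
isAscent (x ∷ xs) = isInv (x ∷ xs) ∧ ascCond x 0 xs

isStaircaseFrom : ℕ → List ℕ → Bool
isStaircaseFrom k []       = true
isStaircaseFrom k (x ∷ xs) = (x ≡ᵇ k) ∧ isStaircaseFrom (suc k) xs

isStaircase : List ℕ → Bool
isStaircase = isStaircaseFrom 0

inA : ℕ → List ℕ → Bool
inA n s = isAscent s ∧ (length s ≡ᵇ n)

inAStar : List ℕ → Bool
inAStar s = isAscent s ∧ not (isStaircase s)

lastTwo : List ℕ → Bool → (ℕ → ℕ → Bool) → Bool
lastTwo []           d f = d
lastTwo (x ∷ [])     d f = d
lastTwo (x ∷ y ∷ []) d f = f x y
lastTwo (x ∷ y ∷ z ∷ xs) d f = lastTwo (y ∷ z ∷ xs) d f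

inP1 : List ℕ → Bool
inP1 s = inAStar s ∧ lastTwo s false (λ x y → (x <ᵇ y) ∧ (y ≡ᵇ asc s))

elemᵇ : ℕ → List ℕ → Bool
elemᵇ v []       = false
elemᵇ v (x ∷ xs) = (v ≡ᵇ x) ∨ elemᵇ v xs

distinct : List ℕ → ℕ
distinct []       = 0
distinct (x ∷ xs) = if elemᵇ x xs then distinct xs else suc (distinct xs)

rep : List ℕ → ℕ
rep s = length s ∸ distinct s

zeroStat : List ℕ → ℕ
zeroStat s = count (λ x → x ≡ᵇ 0) s

maxFrom : ℕ → List ℕ → ℕ
maxFrom k []       = 0
maxFrom k (x ∷ xs) = (if x ≡ᵇ k then 1 else 0) + maxFrom (suc k) xs

maxStat : List ℕ → ℕ
maxStat = maxFrom 0

-- 1-indexed lookup with default 0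
nth1 : List ℕ → ℕ → ℕ
nth1 []       i             = 0
nth1 (x ∷ xs) zero          = 0
nth1 (x ∷ xs) (suc zero)    = x
nth1 (x ∷ xs) (suc (suc i)) = nth1 xs (suc i)

ealm : List ℕ → ℕ
ealm s = if maxStat s ≡ᵇ length s then 0 else nth1 s (suc (maxStat s))

allGt : ℕ → List ℕ → Bool
allGt v []       = true
allGt v (x ∷ xs) = (v <ᵇ x) ∧ allGt v xs

rminPosFrom : ℕ → List ℕ → List ℕ
rminPosFrom k []       = []
rminPosFrom k (x ∷ xs) =
  if allGt x xs then k ∷ rminPosFrom (suc k) xs else rminPosFrom (suc k) xs

rminPos : List ℕ → List ℕ
rminPos = rminPosFrom 1

-- rmin(s) = |Rmin(s)|.  (The values at right-to-left-minimum positions are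
-- pairwise distinct, so this is the number of such positions.)
rmin : List ℕ → ℕ
rmin s = length (rminPos s)

-- the values of the right-to-left minima, left to right; they are strictly
-- increasing, so the j-th entry (from 0) is Rmin(s)_j, the j-th smallest.
RminVals : List ℕ → List ℕ
RminVals s = Data.List.map (nth1 s) (rminPos s)

-- 0-indexed lookup with default 0
nth0 : List ℕ → ℕ → ℕ
nth0 []       i       = 0
nth0 (x ∷ xs) zero    = x
nth0 (x ∷ xs) (suc i) = nth0 xs i

-- condition for m in the definition of rpos:
--  m = 0   : Rmin(s)_0 occurs at least twice in s
--  m ≥ 1   : Rmin(s)_m occurs at least twice strictly after the position of
--            the right-to-left minimum Rmin(s)_{m-1}
rposCond : List ℕ → ℕ → Bool
rposCond s zero    = 2 ≤ᵇ count (λ x → x ≡ᵇ nth0 (RminVals s) 0) s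
rposCond s (suc m) =
  2 ≤ᵇ count (λ x → x ≡ᵇ nth0 (RminVals s) (suc m)) (drop (nth0 (rminPos s) m) s)

maxSat : List ℕ → ℕ → ℕ
maxSat s zero    = 0
maxSat s (suc b) = if rposCond s b then b else maxSat s b

rpos : List ℕ → ℕ
rpos s = if rmin s ≡ᵇ length s then 0 else maxSat s (rmin s)

Dom : ℕ → Set
Dom n = Σ (List ℕ) λ s → T (inA n s ∧ inP1 s)

Cod : ℕ → Set
Cod n = Σ (List ℕ) λ s → T (inA n s ∧ inAStar s)

-- φ₁ deletes the last entry; its inverse appends asc(t) + 1 to t.  Every entry of an
-- ascent sequence t is at most asc(t), so the appended entry y = asc(t) + 1 is a new strict
-- maximum: it adds one ascent and one right-to-left minimum, is neither a repeated value nor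
-- 0, and puts the sequence into P₁.  Moreover y = |t| would force asc(t) = |t| - 1, i.e.
-- t = (0,1,…,|t|-1), which A* excludes; hence max and ealm do not change.  As the largest
-- right-to-left minimum, y occurs only once, and the smaller right-to-left minima keep their
-- positions and counts, so rpos does not change either.  Conversely, the last entry y of
-- s ∈ P₁ exceeds its predecessor, so y = asc(s) = asc(s without y) + 1.
module Submission where

open import Data.Bool using (true; false; _∧_; _∨_; not; if_then_else_; T)
open import Data.Bool.Properties using (T-∧; T-≡; T-irrelevant; ∧-assoc; ∧-identityʳ; ¬-not)
open import Data.Empty using (⊥-elim)
open import Data.List using (List; []; _∷_; [_]; length; map; drop; _∷ʳ_; initLast; _∷ʳ′_)
open import Data.List.Properties
  using (length-++; map-++; length-map; map-cong-local; drop-[]; ∷ʳ-injective)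
open import Data.List.Relation.Unary.All as All using (All; []; _∷_)
open import Data.List.Relation.Unary.All.Properties using (∷ʳ⁻; map⁺)
open import Data.Nat using (ℕ; zero; suc; pred; _≤_; _<_; _+_; _∸_; _≡ᵇ_; _<ᵇ_; z≤n; s≤s)
open import Data.Nat.Properties
open import Data.Product using (Σ; _×_; _,_; proj₁; proj₂)
open import Data.Product.Properties using (Σ-≡,≡→≡)
open import Data.Unit using (tt)
open import Function using (_∘_)
open import Function.Bundles using (_⤖_; Bijection; Equivalence; mk↔ₛ′)
open import Function.Properties.Inverse using (↔⇒⤖)
open import Relation.Nullary using (¬_)
open import Relation.Binary.PropositionalEquality hiding ([_])

open import Defs

T-∧⁺ : ∀ {x y} → T x → T y → T (x ∧ y)
T-∧⁺ p q = Equivalence.from T-∧ (p , q)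

T-∧⁻ : ∀ {x y} → T (x ∧ y) → T x × T y
T-∧⁻ = Equivalence.to T-∧

T-not⁺ : ∀ {x} → ¬ T x → T (not x)
T-not⁺ {false} _ = tt
T-not⁺ {true} ¬t = ¬t tt

T-not⁻ : ∀ {x} → T (not x) → ¬ T x
T-not⁻ {false} _ ()
T-not⁻ {true} ()

≢⇒≡ᵇ≡false : ∀ {m n} → m ≢ n → (m ≡ᵇ n) ≡ false
≢⇒≡ᵇ≡false {m} {n} m≢n = ¬-not (m≢n ∘ ≡ᵇ⇒≡ m n ∘ Equivalence.from T-≡)

<⇒<ᵇ≡true : ∀ {m n} → m < n → (m <ᵇ n) ≡ true
<⇒<ᵇ≡true = Equivalence.to T-≡ ∘ <⇒<ᵇ

2≤ᵇ-false : ∀ {c} → c ≤ 1 → (2 ≤ᵇ c) ≡ false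
2≤ᵇ-false z≤n = refl
2≤ᵇ-false (s≤s z≤n) = refl

length-∷ʳ : ∀ {A : Set} (xs : List A) x → length (xs ∷ʳ x) ≡ suc (length xs)
length-∷ʳ xs x = trans (length-++ xs) (+-comm (length xs) 1)

suc[length-∷ʳ∸1] : ∀ {A : Set} (xs : List A) x → suc (length (xs ∷ʳ x) ∸ 1) ≡ length (xs ∷ʳ x)
suc[length-∷ʳ∸1] xs x rewrite length-∷ʳ xs x = refl

count-∷ʳ-reject : ∀ p (xs : List ℕ) {y} → p y ≡ false → count p (xs ∷ʳ y) ≡ count p xs
count-∷ʳ-reject p [] py rewrite py = refl
count-∷ʳ-reject p (x ∷ xs) py = cong (λ c → if p x then suc c else c) (count-∷ʳ-reject p xs py)

count-drop-∷ʳ-reject : ∀ p j (xs : List ℕ) {y} → p y ≡ false →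
                       count p (drop j (xs ∷ʳ y)) ≡ count p (drop j xs)
count-drop-∷ʳ-reject p zero xs py = count-∷ʳ-reject p xs py
count-drop-∷ʳ-reject p (suc j) [] py = cong (count p) (drop-[] j)
count-drop-∷ʳ-reject p (suc j) (x ∷ xs) py = count-drop-∷ʳ-reject p j xs py

count-drop-≤ : ∀ p j (xs : List ℕ) → count p (drop j xs) ≤ count p xs
count-drop-≤ p zero xs = ≤-refl
count-drop-≤ p (suc j) [] = z≤n
count-drop-≤ p (suc j) (x ∷ xs) with p x
... | true = m≤n⇒m≤1+n (count-drop-≤ p j xs)
... | false = count-drop-≤ p j xs

count-∷ʳ-≤1 : ∀ p (xs : List ℕ) {y} → All (λ x → p x ≡ false) xs → count p (xs ∷ʳ y) ≤ 1
count-∷ʳ-≤1 p [] {y} [] with p y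
... | true = ≤-refl
... | false = z≤n
count-∷ʳ-≤1 p (x ∷ xs) (px ∷ pxs) rewrite px = count-∷ʳ-≤1 p xs pxs

elemᵇ-∷ʳ : ∀ {x y} (xs : List ℕ) → x ≢ y → elemᵇ x (xs ∷ʳ y) ≡ elemᵇ x xs
elemᵇ-∷ʳ [] x≢y rewrite ≢⇒≡ᵇ≡false x≢y = refl
elemᵇ-∷ʳ {x} (z ∷ xs) x≢y = cong ((x ≡ᵇ z) ∨_) (elemᵇ-∷ʳ xs x≢y)

distinct-∷ʳ : ∀ {y} (xs : List ℕ) → All (_≢ y) xs → distinct (xs ∷ʳ y) ≡ suc (distinct xs)
distinct-∷ʳ [] [] = refl
distinct-∷ʳ (x ∷ xs) (x≢y ∷ xs≢y) rewrite elemᵇ-∷ʳ xs x≢y | distinct-∷ʳ xs xs≢y with elemᵇ x xs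
... | true = refl
... | false = refl

rep-∷ʳ : ∀ {y} (xs : List ℕ) → All (_≢ y) xs → rep (xs ∷ʳ y) ≡ rep xs
rep-∷ʳ {y} xs xs≢y = cong₂ _∸_ (length-∷ʳ xs y) (distinct-∷ʳ xs xs≢y)

maxFrom-∷ʳ : ∀ k (xs : List ℕ) {y} → y ≢ k + length xs → maxFrom k (xs ∷ʳ y) ≡ maxFrom k xs
maxFrom-∷ʳ k [] {y} y≢k+0
  rewrite ≢⇒≡ᵇ≡false {y} {k} (λ y≡k → y≢k+0 (trans y≡k (sym (+-identityʳ k)))) = refl
maxFrom-∷ʳ k (x ∷ xs) y≢ = cong ((if x ≡ᵇ k then 1 else 0) +_)
  (maxFrom-∷ʳ (suc k) xs (λ e → y≢ (trans e (sym (+-suc k (length xs))))))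

maxFrom-≤-length : ∀ k (xs : List ℕ) → maxFrom k xs ≤ length xs
maxFrom-≤-length k [] = z≤n
maxFrom-≤-length k (x ∷ xs) with x ≡ᵇ k
... | true = s≤s (maxFrom-≤-length (suc k) xs)
... | false = m≤n⇒m≤1+n (maxFrom-≤-length (suc k) xs)

maxFrom≡length⇒staircaseFrom : ∀ k (xs : List ℕ) → maxFrom k xs ≡ length xs → T (isStaircaseFrom k xs)
maxFrom≡length⇒staircaseFrom k [] _ = tt
maxFrom≡length⇒staircaseFrom k (x ∷ xs) e with x ≡ᵇ k
... | true = maxFrom≡length⇒staircaseFrom (suc k) xs (suc-injective e)
... | false = ⊥-elim (<-irrefl refl (subst (_≤ length xs) e (maxFrom-≤-length (suc k) xs)))

nth1-∷ʳ : ∀ (xs : List ℕ) {y i} → i ≤ length xs → nth1 (xs ∷ʳ y) i ≡ nth1 xs i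
nth1-∷ʳ [] z≤n = refl
nth1-∷ʳ (x ∷ xs) {i = zero} _ = refl
nth1-∷ʳ (x ∷ xs) {i = suc zero} _ = refl
nth1-∷ʳ (x ∷ xs) {i = suc (suc i)} (s≤s i<) = nth1-∷ʳ xs i<

nth1-∷ʳ-last : ∀ (xs : List ℕ) {y} → nth1 (xs ∷ʳ y) (suc (length xs)) ≡ y
nth1-∷ʳ-last [] = refl
nth1-∷ʳ-last (x ∷ xs) = nth1-∷ʳ-last xs

ealm-∷ʳ : ∀ (xs : List ℕ) {y} → y ≢ length xs → maxStat xs ≢ length xs → ealm (xs ∷ʳ y) ≡ ealm xs
ealm-∷ʳ xs {y} y≢len max≢len
  rewrite maxFrom-∷ʳ 0 xs y≢len | length-∷ʳ xs y
        | ≢⇒≡ᵇ≡false (<⇒≢ (s≤s (maxFrom-≤-length 0 xs)))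
        | ≢⇒≡ᵇ≡false max≢len
  = nth1-∷ʳ xs (≤∧≢⇒< (maxFrom-≤-length 0 xs) max≢len)

nth1-≤ : ∀ {m} (xs : List ℕ) i → All (_≤ m) xs → nth1 xs i ≤ m
nth1-≤ [] i _ = z≤n
nth1-≤ (x ∷ xs) zero _ = z≤n
nth1-≤ (x ∷ xs) (suc zero) (x≤m ∷ _) = x≤m
nth1-≤ (x ∷ xs) (suc (suc i)) (_ ∷ xs≤m) = nth1-≤ xs (suc i) xs≤m

nth0-∷ʳ : ∀ (xs : List ℕ) {y i} → i < length xs → nth0 (xs ∷ʳ y) i ≡ nth0 xs i
nth0-∷ʳ (x ∷ xs) {i = zero} _ = refl
nth0-∷ʳ (x ∷ xs) {i = suc i} (s≤s i<) = nth0-∷ʳ xs i<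

nth0-∷ʳ-last : ∀ (xs : List ℕ) {y} → nth0 (xs ∷ʳ y) (length xs) ≡ y
nth0-∷ʳ-last [] = refl
nth0-∷ʳ-last (x ∷ xs) = nth0-∷ʳ-last xs

nth0-≤ : ∀ {m} (xs : List ℕ) i → All (_≤ m) xs → nth0 xs i ≤ m
nth0-≤ [] i _ = z≤n
nth0-≤ (x ∷ xs) zero (x≤m ∷ _) = x≤m
nth0-≤ (x ∷ xs) (suc i) (_ ∷ xs≤m) = nth0-≤ xs i xs≤m

allGt-∷ʳ : ∀ {x y} (xs : List ℕ) → x < y → allGt x (xs ∷ʳ y) ≡ allGt x xs
allGt-∷ʳ [] x<y rewrite <⇒<ᵇ≡true x<y = refl
allGt-∷ʳ {x} (z ∷ xs) x<y = cong ((x <ᵇ z) ∧_) (allGt-∷ʳ xs x<y)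

rminPosFrom-∷ʳ : ∀ {y} k (xs : List ℕ) → All (_< y) xs →
                 rminPosFrom k (xs ∷ʳ y) ≡ rminPosFrom k xs ∷ʳ (k + length xs)
rminPosFrom-∷ʳ k [] [] rewrite +-identityʳ k = refl
rminPosFrom-∷ʳ k (x ∷ xs) (x<y ∷ xs<y)
  rewrite allGt-∷ʳ xs x<y | rminPosFrom-∷ʳ (suc k) xs xs<y | +-suc k (length xs) with allGt x xs
... | true = refl
... | false = refl

rminPosFrom-< : ∀ k (xs : List ℕ) → All (_< k + length xs) (rminPosFrom k xs)
rminPosFrom-< k [] = []
rminPosFrom-< k (x ∷ xs) rewrite +-suc k (length xs) with allGt x xs
... | true = s≤s (m≤m+n k (length xs)) ∷ rminPosFrom-< (suc k) xs
... | false = rminPosFrom-< (suc k) xs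

rmin-∷ʳ : ∀ {y} (xs : List ℕ) → All (_< y) xs → rmin (xs ∷ʳ y) ≡ rmin xs + 1
rmin-∷ʳ xs xs<y = trans (cong length (rminPosFrom-∷ʳ 1 xs xs<y)) (length-++ (rminPos xs))

RminVals-∷ʳ : ∀ {y} (xs : List ℕ) → All (_< y) xs → RminVals (xs ∷ʳ y) ≡ RminVals xs ∷ʳ y
RminVals-∷ʳ {y} xs xs<y = begin
    map (nth1 s) (rminPos s)
  ≡⟨ cong (map (nth1 s)) (rminPosFrom-∷ʳ 1 xs xs<y) ⟩
    map (nth1 s) (rminPos xs ∷ʳ suc (length xs))
  ≡⟨ map-++ (nth1 s) (rminPos xs) _ ⟩
    map (nth1 s) (rminPos xs) ∷ʳ nth1 s (suc (length xs))
  ≡⟨ cong₂ _∷ʳ_ (map-cong-local (All.map (λ i≤n → nth1-∷ʳ xs (≤-pred i≤n)) (rminPosFrom-< 1 xs)))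
                (nth1-∷ʳ-last xs) ⟩
    map (nth1 xs) (rminPos xs) ∷ʳ y
  ∎
  where
  s = xs ∷ʳ y
  open ≡-Reasoning

RminVals-≤ : ∀ {m} (xs : List ℕ) → All (_≤ m) xs → All (_≤ m) (RminVals xs)
RminVals-≤ xs xs≤m = map⁺ (All.universal (λ i → nth1-≤ xs i xs≤m) (rminPos xs))

rposCond-cong : ∀ s t b → nth0 (RminVals s) b ≡ nth0 (RminVals t) b →
  nth0 (rminPos s) (pred b) ≡ nth0 (rminPos t) (pred b) →
  (∀ j → count (_≡ᵇ nth0 (RminVals t) b) (drop j s) ≡ count (_≡ᵇ nth0 (RminVals t) b) (drop j t)) →
  rposCond s b ≡ rposCond t b
rposCond-cong s t zero val _ cnt rewrite val = cong (2 ≤ᵇ_) (cnt 0)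
rposCond-cong s t (suc b) val pos cnt rewrite val | pos = cong (2 ≤ᵇ_) (cnt (nth0 (rminPos t) b))

rposCond-false : ∀ s b → (∀ j → count (_≡ᵇ nth0 (RminVals s) b) (drop j s) ≤ 1) → rposCond s b ≡ false
rposCond-false s zero few = 2≤ᵇ-false (few 0)
rposCond-false s (suc b) few = 2≤ᵇ-false (few (nth0 (rminPos s) b))

maxSat-cong : ∀ s t c → (∀ b → b < c → rposCond s b ≡ rposCond t b) → maxSat s c ≡ maxSat t c
maxSat-cong s t zero _ = refl
maxSat-cong s t (suc c) same rewrite same c ≤-refl with rposCond t c
... | true = refl
... | false = maxSat-cong s t c (λ b b<c → same b (m<n⇒m<1+n b<c))

rpos-extend : ∀ s t → rmin s ≡ suc (rmin t) → length s ≡ suc (length t) → rposCond s (rmin t) ≡ false →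
              (∀ b → b < rmin t → rposCond s b ≡ rposCond t b) → rpos s ≡ rpos t
rpos-extend s t #rmin #s top lower rewrite #rmin | #s with rmin t ≡ᵇ length t
... | true = refl
... | false rewrite top = maxSat-cong s t (rmin t) lower

rpos-∷ʳ : ∀ {m} (xs : List ℕ) → All (_≤ m) xs → rpos (xs ∷ʳ suc m) ≡ rpos xs
rpos-∷ʳ {m} xs xs≤m =
  rpos-extend s xs (trans (rmin-∷ʳ xs xs<y) (+-comm (rmin xs) 1)) (length-∷ʳ xs y) top-once lower-same
  where
  y = suc m
  s = xs ∷ʳ y
  xs<y : All (_< y) xs
  xs<y = All.map s≤s xs≤m
  vals : RminVals s ≡ RminVals xs ∷ʳ y
  vals = RminVals-∷ʳ xs xs<y
  #vals : length (RminVals xs) ≡ rmin xs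
  #vals = length-map (nth1 xs) (rminPos xs)

  top-is-y : nth0 (RminVals s) (rmin xs) ≡ y
  top-is-y = trans (cong (λ vs → nth0 vs (rmin xs)) vals)
                   (subst (λ r → nth0 (RminVals xs ∷ʳ y) r ≡ y) #vals (nth0-∷ʳ-last (RminVals xs)))

  top-once : rposCond s (rmin xs) ≡ false
  top-once = rposCond-false s (rmin xs) λ j → begin
      count (_≡ᵇ nth0 (RminVals s) (rmin xs)) (drop j s)
    ≡⟨ cong (λ v → count (_≡ᵇ v) (drop j s)) top-is-y ⟩
      count (_≡ᵇ y) (drop j s)
    ≤⟨ count-drop-≤ (_≡ᵇ y) j s ⟩
      count (_≡ᵇ y) s
    ≤⟨ count-∷ʳ-≤1 (_≡ᵇ y) xs (All.map (λ x<y → ≢⇒≡ᵇ≡false (<⇒≢ x<y)) xs<y) ⟩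
      1
    ∎
    where open ≤-Reasoning

  lower-same : ∀ b → b < rmin xs → rposCond s b ≡ rposCond xs b
  lower-same b b<R = rposCond-cong s xs b same-value same-position same-count
    where
    same-value : nth0 (RminVals s) b ≡ nth0 (RminVals xs) b
    same-value = trans (cong (λ vs → nth0 vs b) vals)
                       (nth0-∷ʳ (RminVals xs) (subst (b <_) (sym #vals) b<R))
    same-position : nth0 (rminPos s) (pred b) ≡ nth0 (rminPos xs) (pred b)
    same-position = trans (cong (λ ps → nth0 ps (pred b)) (rminPosFrom-∷ʳ 1 xs xs<y))
                          (nth0-∷ʳ (rminPos xs) (≤-<-trans pred[n]≤n b<R))
    value≤m : nth0 (RminVals xs) b ≤ m
    value≤m = nth0-≤ (RminVals xs) b (RminVals-≤ xs xs≤m)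
    same-count : ∀ j → count (_≡ᵇ nth0 (RminVals xs) b) (drop j s)
                     ≡ count (_≡ᵇ nth0 (RminVals xs) b) (drop j xs)
    same-count j = count-drop-∷ʳ-reject _ j xs (≢⇒≡ᵇ≡false (>⇒≢ (s≤s value≤m)))

asc-∷ʳ-∷ʳ : ∀ (xs : List ℕ) {x y} → x < y → asc (xs ∷ʳ x ∷ʳ y) ≡ asc (xs ∷ʳ x) + 1
asc-∷ʳ-∷ʳ [] x<y rewrite <⇒<ᵇ≡true x<y = refl
asc-∷ʳ-∷ʳ (a ∷ []) {x} x<y =
  trans (cong (d +_) (asc-∷ʳ-∷ʳ [] x<y)) (sym (+-assoc d _ 1)) where d = if a <ᵇ x then 1 else 0
asc-∷ʳ-∷ʳ (a ∷ b ∷ xs) x<y =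
  trans (cong (d +_) (asc-∷ʳ-∷ʳ (b ∷ xs) x<y)) (sym (+-assoc d _ 1)) where d = if a <ᵇ b then 1 else 0

asc-≤-length : ∀ x xs → asc (x ∷ xs) ≤ length xs
asc-≤-length x [] = z≤n
asc-≤-length x (y ∷ xs) with x <ᵇ y
... | true = s≤s (asc-≤-length y xs)
... | false = m≤n⇒m≤1+n (asc-≤-length y xs)

asc-≤-length∸1 : ∀ t → asc t ≤ length t ∸ 1
asc-≤-length∸1 [] = z≤n
asc-≤-length∸1 (x ∷ xs) = asc-≤-length x xs

lastTwo-∷ʳ-∷ʳ : ∀ (xs : List ℕ) {x y d f} → lastTwo (xs ∷ʳ x ∷ʳ y) d f ≡ f x y
lastTwo-∷ʳ-∷ʳ [] = refl
lastTwo-∷ʳ-∷ʳ (a ∷ []) = refl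
lastTwo-∷ʳ-∷ʳ (a ∷ b ∷ []) = refl
lastTwo-∷ʳ-∷ʳ (a ∷ b ∷ c ∷ xs) = lastTwo-∷ʳ-∷ʳ (b ∷ c ∷ xs)

isInvFrom-∷ʳ : ∀ k (xs : List ℕ) y → isInvFrom k (xs ∷ʳ y) ≡ isInvFrom k xs ∧ (y <ᵇ k + length xs)
isInvFrom-∷ʳ k [] y rewrite +-identityʳ k = ∧-identityʳ (y <ᵇ k)
isInvFrom-∷ʳ k (x ∷ xs) y rewrite isInvFrom-∷ʳ (suc k) xs y | +-suc k (length xs) =
  sym (∧-assoc (x <ᵇ k) (isInvFrom (suc k) xs) _)

isStaircaseFrom-∷ʳ : ∀ k (xs : List ℕ) y →
                     isStaircaseFrom k (xs ∷ʳ y) ≡ isStaircaseFrom k xs ∧ (y ≡ᵇ k + length xs)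
isStaircaseFrom-∷ʳ k [] y rewrite +-identityʳ k = ∧-identityʳ (y ≡ᵇ k)
isStaircaseFrom-∷ʳ k (x ∷ xs) y rewrite isStaircaseFrom-∷ʳ (suc k) xs y | +-suc k (length xs) =
  sym (∧-assoc (x ≡ᵇ k) (isStaircaseFrom (suc k) xs) _)

ascCond-∷ʳ : ∀ prev c (xs : List ℕ) y →
             ascCond prev c (xs ∷ʳ y) ≡ ascCond prev c xs ∧ (y ≤ᵇ suc (c + asc (prev ∷ xs)))
ascCond-∷ʳ prev c [] y rewrite +-identityʳ c = ∧-identityʳ (y ≤ᵇ suc c)
ascCond-∷ʳ prev c (x ∷ xs) y = begin
    (x ≤ᵇ suc c) ∧ ascCond x (d + c) (xs ∷ʳ y)
  ≡⟨ cong ((x ≤ᵇ suc c) ∧_) (ascCond-∷ʳ x (d + c) xs y) ⟩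
    (x ≤ᵇ suc c) ∧ (ascCond x (d + c) xs ∧ (y ≤ᵇ suc (d + c + asc (x ∷ xs))))
  ≡⟨ sym (∧-assoc (x ≤ᵇ suc c) _ _) ⟩
    ((x ≤ᵇ suc c) ∧ ascCond x (d + c) xs) ∧ (y ≤ᵇ suc (d + c + asc (x ∷ xs)))
  ≡⟨ cong (λ a → ((x ≤ᵇ suc c) ∧ ascCond x (d + c) xs) ∧ (y ≤ᵇ suc a))
          (trans (cong (_+ asc (x ∷ xs)) (+-comm d c)) (+-assoc c d _)) ⟩
    ((x ≤ᵇ suc c) ∧ ascCond x (d + c) xs) ∧ (y ≤ᵇ suc (c + (d + asc (x ∷ xs))))
  ∎
  where
  d = if prev <ᵇ x then 1 else 0
  open ≡-Reasoning

ascCond⇒≤ : ∀ prev c xs → T (ascCond prev c xs) → prev ≤ c → All (_≤ c + asc (prev ∷ xs)) (prev ∷ xs)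
ascCond⇒≤ prev c [] _ prev≤c = ≤-trans prev≤c (m≤m+n c 0) ∷ []
ascCond⇒≤ prev c (x ∷ xs) cond prev≤c with prev <ᵇ x in prev<ᵇx
... | true = ≤-trans prev≤c (m≤m+n c _)
           ∷ subst (λ b → All (_≤ b) (x ∷ xs)) (sym (+-suc c _))
                   (ascCond⇒≤ x (suc c) xs (proj₂ (T-∧⁻ cond))
                              (≤-pred (<ᵇ⇒< x (suc (suc c)) (proj₁ (T-∧⁻ cond)))))
... | false = ≤-trans prev≤c (m≤m+n c _)
            ∷ ascCond⇒≤ x c xs (proj₂ (T-∧⁻ cond))
                        (≤-trans (≮⇒≥ (λ prev<x → subst T prev<ᵇx (<⇒<ᵇ prev<x))) prev≤c)

ascent-≤-asc : ∀ t → T (isAscent t) → All (_≤ asc t) t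
ascent-≤-asc [] _ = []
ascent-≤-asc (zero ∷ u) ascent = ascCond⇒≤ 0 0 u (proj₂ (T-∧⁻ ascent)) z≤n
ascent-≤-asc (suc a ∷ u) ()

ascent⇒inv : ∀ t → T (isAscent t) → T (isInv t)
ascent⇒inv [] _ = tt
ascent⇒inv (a ∷ u) ascent = proj₁ (T-∧⁻ ascent)

isAscent-∷ʳ⁻ : ∀ t {y} → T (isAscent (t ∷ʳ y)) → T (isAscent t)
isAscent-∷ʳ⁻ [] _ = tt
isAscent-∷ʳ⁻ (a ∷ u) {y} ascent = T-∧⁺ {isInv (a ∷ u)} (proj₁ (T-∧⁻ inv)) (proj₁ (T-∧⁻ cond))
  where
  inv : T (isInv (a ∷ u) ∧ (y <ᵇ 1 + length (a ∷ u)))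
  inv = subst T (isInvFrom-∷ʳ 1 (a ∷ u) y) (proj₁ (T-∧⁻ ascent))
  cond : T (ascCond a 0 u ∧ (y ≤ᵇ suc (asc (a ∷ u))))
  cond = subst T (ascCond-∷ʳ a 0 u y) (proj₂ (T-∧⁻ ascent))

isAscent-∷ʳ⁺ : ∀ t {y} → T (isAscent t) → y ≤ length t → y ≤ suc (asc t) → T (isAscent (t ∷ʳ y))
isAscent-∷ʳ⁺ [] _ z≤n _ = tt
isAscent-∷ʳ⁺ (a ∷ u) {y} ascent y≤len y≤1+asc =
  T-∧⁺ (subst T (sym (isInvFrom-∷ʳ 1 (a ∷ u) y)) (T-∧⁺ (proj₁ (T-∧⁻ ascent)) (<⇒<ᵇ (s≤s y≤len))))
       (subst T (sym (ascCond-∷ʳ a 0 u y)) (T-∧⁺ (proj₂ (T-∧⁻ ascent)) (<⇒<ᵇ (s≤s y≤1+asc))))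

staircaseFrom⇒asc≡length∸1 : ∀ k t → T (isStaircaseFrom k t) → asc t ≡ length t ∸ 1
staircaseFrom⇒asc≡length∸1 k [] _ = refl
staircaseFrom⇒asc≡length∸1 k (a ∷ []) _ = refl
staircaseFrom⇒asc≡length∸1 k (a ∷ b ∷ u) stair =
  cong₂ (λ c r → (if c then 1 else 0) + r) a<ᵇb (staircaseFrom⇒asc≡length∸1 (suc k) (b ∷ u) stair′)
  where
  stair′ : T (isStaircaseFrom (suc k) (b ∷ u))
  stair′ = proj₂ (T-∧⁻ {a ≡ᵇ k} stair)
  a<ᵇb : (a <ᵇ b) ≡ true
  a<ᵇb = <⇒<ᵇ≡true (subst₂ _<_ (sym (≡ᵇ⇒≡ a k (proj₁ (T-∧⁻ stair))))
                                (sym (≡ᵇ⇒≡ b (suc k) (proj₁ (T-∧⁻ stair′)))) (n<1+n k))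

-- The entry after k is at most k + 1, and it must exceed k to keep all ascents.
asc≡length⇒staircaseFrom : ∀ k xs → T (isInvFrom (suc (suc k)) xs) → asc (k ∷ xs) ≡ length xs →
                           T (isStaircaseFrom (suc k) xs)
asc≡length⇒staircaseFrom k [] _ _ = tt
asc≡length⇒staircaseFrom k (x ∷ xs) inv e with k <ᵇ x in k<ᵇx
... | false = ⊥-elim (<-irrefl refl (subst (_≤ length xs) e (asc-≤-length x xs)))
... | true with ≤-antisym (≤-pred (<ᵇ⇒< x (suc (suc k)) (proj₁ (T-∧⁻ inv))))
                          (<ᵇ⇒< k x (Equivalence.from T-≡ k<ᵇx))
...   | refl = T-∧⁺ (≡⇒≡ᵇ (suc k) (suc k) refl)
                    (asc≡length⇒staircaseFrom (suc k) xs (proj₂ (T-∧⁻ inv)) (suc-injective e))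

inv-asc≡length∸1⇒staircase : ∀ t → T (isInv t) → asc t ≡ length t ∸ 1 → T (isStaircase t)
inv-asc≡length∸1⇒staircase [] _ _ = tt
inv-asc≡length∸1⇒staircase (zero ∷ u) inv e = asc≡length⇒staircaseFrom 0 u inv e
inv-asc≡length∸1⇒staircase (suc a ∷ u) ()

appendAsc : List ℕ → List ℕ
appendAsc t = t ∷ʳ suc (asc t)

StatsCorrespond : List ℕ → List ℕ → Set
StatsCorrespond s t =
  (asc s ≡ asc t + 1) × (rmin s ≡ rmin t + 1) × (rep s ≡ rep t) × (zeroStat s ≡ zeroStat t) ×
  (maxStat s ≡ maxStat t) × (ealm s ≡ ealm t) × (rpos s ≡ rpos t)

appendAsc-stats : ∀ t → T (inAStar t) → StatsCorrespond (appendAsc t) t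
appendAsc-stats t t∈A* with initLast t
appendAsc-stats _ t∈A* | [] = ⊥-elim t∈A*
appendAsc-stats _ t∈A* | xs ∷ʳ′ x =
  asc-∷ʳ-∷ʳ xs (s≤s (proj₂ (∷ʳ⁻ t≤a))) , rmin-∷ʳ t t<y , rep-∷ʳ t (All.map <⇒≢ t<y) ,
  count-∷ʳ-reject _ t refl , maxFrom-∷ʳ 0 t y≢len , ealm-∷ʳ t y≢len max≢len , rpos-∷ʳ t t≤a
  where
  t = xs ∷ʳ x
  t-asc : T (isAscent t)
  t-asc = proj₁ (T-∧⁻ t∈A*)
  t-nonStair : ¬ T (isStaircase t)
  t-nonStair = T-not⁻ (proj₂ (T-∧⁻ t∈A*))
  t≤a : All (_≤ asc t) t
  t≤a = ascent-≤-asc t t-asc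
  t<y : All (_< suc (asc t)) t
  t<y = All.map s≤s t≤a
  y≢len : suc (asc t) ≢ length t
  y≢len = t-nonStair ∘ inv-asc≡length∸1⇒staircase t (ascent⇒inv t t-asc) ∘ cong (_∸ 1)
  max≢len : maxStat t ≢ length t
  max≢len = t-nonStair ∘ maxFrom≡length⇒staircaseFrom 0 t

Cod-intro : ∀ {m} t → T (isAscent t) → length t ≡ m → ¬ T (isStaircase t) → T (inA m t ∧ inAStar t)
Cod-intro t ascent len nonStair = T-∧⁺ (T-∧⁺ ascent (≡⇒≡ᵇ _ _ len)) (T-∧⁺ ascent (T-not⁺ nonStair))

Cod-elim : ∀ {m} t → T (inA m t ∧ inAStar t) → T (isAscent t) × length t ≡ m × ¬ T (isStaircase t)
Cod-elim {m} t t∈Cod =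
  let t∈A , t∈A* = T-∧⁻ t∈Cod
      ascent , len = T-∧⁻ t∈A
      _ , nonStair = T-∧⁻ t∈A*
  in ascent , ≡ᵇ⇒≡ (length t) m len , T-not⁻ nonStair

Dom-intro : ∀ {n} xs {x y} → let s = xs ∷ʳ x ∷ʳ y in
  T (isAscent s) → length s ≡ n → ¬ T (isStaircase s) → x < y → y ≡ asc s → T (inA n s ∧ inP1 s)
Dom-intro xs ascent len nonStair x<y y≡asc =
  T-∧⁺ (T-∧⁺ ascent (≡⇒≡ᵇ _ _ len))
       (T-∧⁺ (T-∧⁺ ascent (T-not⁺ nonStair))
             (subst T (sym (lastTwo-∷ʳ-∷ʳ xs)) (T-∧⁺ (<⇒<ᵇ x<y) (≡⇒≡ᵇ _ _ y≡asc))))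

Dom-elim : ∀ {n} xs {x y} → let s = xs ∷ʳ x ∷ʳ y in T (inA n s ∧ inP1 s) →
  T (isAscent s) × length s ≡ n × ¬ T (isStaircase s) × x < y × y ≡ asc s
Dom-elim {n} xs {x} {y} s∈Dom =
  let s∈A , s∈P₁ = T-∧⁻ s∈Dom
      ascent , len = T-∧⁻ s∈A
      s∈A* , lastTwo-holds = T-∧⁻ s∈P₁
      _ , nonStair = T-∧⁻ s∈A*
      x<ᵇy , y≡ᵇasc = T-∧⁻ (subst T (lastTwo-∷ʳ-∷ʳ xs) lastTwo-holds)
  in ascent , ≡ᵇ⇒≡ _ n len , T-not⁻ nonStair , <ᵇ⇒< x y x<ᵇy , ≡ᵇ⇒≡ y _ y≡ᵇasc

appendAsc-∈Dom : ∀ {m} t → T (inA m t ∧ inAStar t) →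
                 T (inA (suc m) (appendAsc t) ∧ inP1 (appendAsc t))
appendAsc-∈Dom t t∈Cod with initLast t
appendAsc-∈Dom {m} _ t∈Cod | [] = ⊥-elim (proj₂ (proj₂ (Cod-elim {m} [] t∈Cod)) tt)
appendAsc-∈Dom _ t∈Cod | xs ∷ʳ′ x with Cod-elim (xs ∷ʳ x) t∈Cod
... | ascent , len , nonStair =
  Dom-intro xs (isAscent-∷ʳ⁺ t ascent y≤len ≤-refl) (trans (length-∷ʳ t y) (cong suc len))
            s-nonStair x<y (sym (trans (asc-∷ʳ-∷ʳ xs x<y) (+-comm (asc t) 1)))
  where
  t = xs ∷ʳ x
  y = suc (asc t)
  y≤len : y ≤ length t
  y≤len = subst (y ≤_) (suc[length-∷ʳ∸1] xs x) (s≤s (asc-≤-length∸1 t))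
  x<y : x < y
  x<y = s≤s (proj₂ (∷ʳ⁻ (ascent-≤-asc t ascent)))
  s-nonStair : ¬ T (isStaircase (t ∷ʳ y))
  s-nonStair stair = nonStair (proj₁ (T-∧⁻ (subst T (isStaircaseFrom-∷ʳ 0 t y) stair)))

init-∈Cod : ∀ {m} xs {x y} → let t = xs ∷ʳ x in
  T (inA (suc m) (t ∷ʳ y) ∧ inP1 (t ∷ʳ y)) → T (inA m t ∧ inAStar t) × y ≡ suc (asc t)
init-∈Cod xs {x} {y} s∈Dom with Dom-elim xs s∈Dom
... | ascent , len , nonStair , x<y , y≡asc =
  Cod-intro t (isAscent-∷ʳ⁻ t ascent) (suc-injective (trans (sym (length-∷ʳ t y)) len)) t-nonStair ,
  y≡1+asc
  where
  t = xs ∷ʳ x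
  y≡1+asc : y ≡ suc (asc t)
  y≡1+asc = trans y≡asc (trans (asc-∷ʳ-∷ʳ xs x<y) (+-comm (asc t) 1))
  t-nonStair : ¬ T (isStaircase t)
  t-nonStair stair =
    nonStair (subst T (sym (isStaircaseFrom-∷ʳ 0 t y)) (T-∧⁺ stair (≡⇒≡ᵇ y (length t) y≡len)))
    where
    y≡len : y ≡ length t
    y≡len = trans y≡1+asc
                  (trans (cong suc (staircaseFrom⇒asc≡length∸1 0 t stair)) (suc[length-∷ʳ∸1] xs x))

Dom-split : ∀ {m} s → T (inA (suc m) s ∧ inP1 s) →
            Σ (List ℕ) λ t → T (inA m t ∧ inAStar t) × s ≡ appendAsc t
Dom-split s s∈Dom with initLast s
Dom-split _ () | []
Dom-split _ s∈Dom | t ∷ʳ′ y with initLast t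
Dom-split {m} _ s∈Dom | _ ∷ʳ′ y | [] =
  ⊥-elim (proj₂ (T-∧⁻ (proj₂ (T-∧⁻ {inA (suc m) [ y ]} s∈Dom))))
Dom-split _ s∈Dom | _ ∷ʳ′ y | xs ∷ʳ′ x =
  let t∈Cod , y≡1+asc = init-∈Cod xs s∈Dom in xs ∷ʳ x , t∈Cod , cong (xs ∷ʳ x ∷ʳ_) y≡1+asc

φ₁ : ∀ m → Dom (suc m) ⤖ Cod m
φ₁ m = ↔⇒⤖ (mk↔ₛ′ to from to∘from from∘to)
  where
  to : Dom (suc m) → Cod m
  to (s , s∈Dom) = let t , t∈Cod , _ = Dom-split s s∈Dom in t , t∈Cod
  from : Cod m → Dom (suc m)
  from (t , t∈Cod) = appendAsc t , appendAsc-∈Dom t t∈Cod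
  to∘from : ∀ c → to (from c) ≡ c
  to∘from (t , t∈Cod) =
    let _ , _ , appended≡ = Dom-split (appendAsc t) (appendAsc-∈Dom t t∈Cod)
    in Σ-≡,≡→≡ (sym (proj₁ (∷ʳ-injective t _ appended≡)) , T-irrelevant _ _)
  from∘to : ∀ d → from (to d) ≡ d
  from∘to (s , s∈Dom) = Σ-≡,≡→≡ (sym (proj₂ (proj₂ (Dom-split s s∈Dom))) , T-irrelevant _ _)

φ₁-stats : ∀ m (d : Dom (suc m)) → StatsCorrespond (proj₁ d) (proj₁ (Bijection.to (φ₁ m) d))
φ₁-stats m (s , s∈Dom) =
  let t , t∈Cod , s≡appendAsc-t = Dom-split s s∈Dom
  in subst (λ z → StatsCorrespond z t) (sym s≡appendAsc-t)
           (appendAsc-stats t (proj₂ (T-∧⁻ {inA m t} t∈Cod)))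

-- 2 ≤ n is only needed to rule out n = 0; for n = 1 both sides are empty.
lemma16 : (n : ℕ) → 2 ≤ n →
    Σ (Dom n ⤖ Cod (n ∸ 1)) λ φ →
      (s : Dom n) →
        (asc (proj₁ s) ≡ asc (proj₁ (Bijection.to φ s)) + 1) ×
        (rmin (proj₁ s) ≡ rmin (proj₁ (Bijection.to φ s)) + 1) ×
        (rep (proj₁ s) ≡ rep (proj₁ (Bijection.to φ s))) ×
        (zeroStat (proj₁ s) ≡ zeroStat (proj₁ (Bijection.to φ s))) ×
        (maxStat (proj₁ s) ≡ maxStat (proj₁ (Bijection.to φ s))) ×
        (ealm (proj₁ s) ≡ ealm (proj₁ (Bijection.to φ s))) ×
        (rpos (proj₁ s) ≡ rpos (proj₁ (Bijection.to φ s)))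
lemma16 zero ()
lemma16 (suc m) _ = φ₁ m , φ₁-stats m
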